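{- Let $(G,\mathcal{P})$ be a single-flow directed multipartite graph with three layers, $|V_1(G)|=a$, $|V_2(G)|=b$, $|V_3(G)|=c$. Then $|\operatorname{Jac}(G)|=b^a\cdot c^{\,b-1}$.
   Context: A single-flow directed multipartite graph with $t$ layers is a directed graph $G$ with a partition $V(G)=V_1(G)\sqcup\dots\sqcup V_t(G)$ into nonempty parts such that the arrows of $G$ are exactly one one-directional arrow $u\to v$ for each $i\in\{1,\dots,t-1\}$, $u\in V_i(G)$, $v\in V_{i+1}(G)$. The Laplacian $L_G$ of a directed graph on $v_1,\dots,v_n$ is the $n\times n$ integer matrix with $(i,i)$ entry the number of outgoing arrows of $v_i$ and $(i,j)$ entry ($i\ne j$) minus the number of arrows from $v_i$ to $v_j$. $\operatorname{Pic}(G)=\mathbb{Z}^n/L_G^T\mathbb{Z}^n$ and $\operatorname{Jac}(G)$ is its (finite) torsion subgroup. -}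

module Defs where

open import Data.Nat as ℕ using (ℕ; zero; suc)
open import Data.Integer as ℤ using (ℤ; +_)
open import Data.Fin using (Fin; zero; suc; toℕ)
open import Data.Fin as F using ()
open import Data.Bool using (Bool; true; false; if_then_else_)
open import Data.Product using (Σ; _×_)
open import Relation.Nullary using (¬_; does)
open import Relation.Binary.PropositionalEquality using (_≡_)

sumℕ : ∀ {n} → (Fin n → ℕ) → ℕ
sumℕ {zero} f = 0
sumℕ {suc n} f = f zero ℕ.+ sumℕ (λ i → f (suc i))

sumℤ : ∀ {n} → (Fin n → ℤ) → ℤ
sumℤ {zero} f = + 0
sumℤ {suc n} f = f zero ℤ.+ sumℤ (λ i → f (suc i))

count : ∀ {n} → (Fin n → Bool) → ℕ
count p = sumℕ (λ i → if p i then 1 else 0)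

-- A directed multigraph on vertices v_0..v_{n-1}: A u v = number of arrows u → v
Digraph : ℕ → Set
Digraph n = Fin n → Fin n → ℕ

outdeg : ∀ {n} → Digraph n → Fin n → ℕ
outdeg A u = sumℕ (A u)

Laplacian : ∀ {n} → Digraph n → Fin n → Fin n → ℤ
Laplacian A i j = if does (i F.≟ j) then + outdeg A i else ℤ.- (+ A i j)

Vecℤ : ℕ → Set
Vecℤ n = Fin n → ℤ

-- x lies in the column space L_G^T ℤ^n, i.e. x_i = Σ_j (L^T)_{ij} z_j = Σ_j L_{ji} z_j
InImage : ∀ {n} → Digraph n → Vecℤ n → Set
InImage {n} A x = Σ (Vecℤ n) λ z → ∀ i → x i ≡ sumℤ (λ j → Laplacian A j i ℤ.* z j)

-- equality in Pic(G) = ℤ^n / L_G^T ℤ^n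
PicEq : ∀ {n} → Digraph n → Vecℤ n → Vecℤ n → Set
PicEq A x y = InImage A (λ i → x i ℤ.- y i)

IsTorsion : ∀ {n} → Digraph n → Vecℤ n → Set
IsTorsion A x = Σ ℕ λ m → (1 ℕ.≤ m) × InImage A (λ i → + m ℤ.* x i)

-- |Jac(G)| = N : a bijection between Fin N and Jac(G) (torsion classes of Pic(G) modulo PicEq)
JacHasOrder : ∀ {n} → Digraph n → ℕ → Set
JacHasOrder {n} A N =
  Σ (Fin N → Vecℤ n) λ f →
    (∀ k → IsTorsion A (f k)) ×
    (∀ k l → PicEq A (f k) (f l) → k ≡ l) ×
    (∀ x → IsTorsion A x → Σ (Fin N) λ k → PicEq A (f k) x)

-- (G, layer) is a single-flow directed multipartite graph with 3 layers
-- (layer u = i means u ∈ V_{i+1}): exactly one arrow u → v when v is in the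
-- layer right after u's, and no other arrows.
SingleFlow3 : ∀ {n} → Digraph n → (Fin n → Fin 3) → Set
SingleFlow3 A layer = ∀ u v →
  (toℕ (layer v) ≡ suc (toℕ (layer u)) → A u v ≡ 1) ×
  (¬ (toℕ (layer v) ≡ suc (toℕ (layer u))) → A u v ≡ 0)

layerSize : ∀ {n} → (Fin n → Fin 3) → Fin 3 → ℕ
layerSize layer i = count (λ v → does (layer v F.≟ i))

module Submission where

-- Write V₁, V₂, V₃ (layers 0F, 1F, 2F) for the layers, of sizes a, b, c. The transpose Laplacian acts
-- layer by layer: (Lᵀ z)ᵢ is b zᵢ on V₁, c zᵢ − Σ_{V₁} z on V₂ and −Σ_{V₂} z on V₃. Hence x is torsion
-- in Pic(G) iff x is constant on V₃ and sums to 0. Fix v₀ ∈ V₂. Firing V₁ reduces x modulo b there,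
-- firing V₂ reduces it modulo c, and firing v₀ once more clears V₃; so every torsion class has exactly
-- one representative with entries in [0,b) on V₁, in [0,c) on V₂ ∖ {v₀} and 0 on V₃, its entry at v₀
-- being forced by the zero sum. Reading these entries as mixed-radix digits counts b^a c^(b−1) classes.

open import Defs
open import Algebra.Bundles using (CommutativeMonoid)
open import Data.Bool using (if_then_else_)
open import Data.Fin as F using (Fin; zero; suc; toℕ; punchIn)
open import Data.Fin.Patterns using (0F; 1F; 2F)
import Data.Fin.Properties as FP
open import Data.Integer using (ℤ; +_; -[1+_]; 0ℤ; 1ℤ; _+_; _*_; -_; _-_)
open import Data.Integer.DivMod using (_/ℕ_; _%ℕ_; n%ℕd<d; a≡a%ℕn+[a/ℕn]*n)
import Data.Integer.Properties as ℤP
open import Data.Integer.Tactic.RingSolver using (solve-∀)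
open import Data.Nat as ℕ using (ℕ; zero; suc)
import Data.Nat.Properties as ℕP
open import Data.Nat.Tactic.RingSolver using () renaming (solve-∀ to ℕ-solve-∀)
open import Data.Product using (Σ; _×_; _,_; proj₁; proj₂)
open import Data.Vec.Functional using (Vector; removeAt)
open import Function using (_∘_)
open import Relation.Binary.PropositionalEquality
  using (_≡_; _≢_; refl; sym; trans; cong; cong₂; subst; module ≡-Reasoning)
open import Relation.Nullary using (Dec; does; yes; no; contradiction)

module _ {c ℓ} (M : CommutativeMonoid c ℓ) where
  open CommutativeMonoid M
  open import Algebra.Properties.CommutativeMonoid.Sum M using (sum; sum-remove; sum-cong-≋)
  open import Relation.Binary.Reasoning.Setoid setoid

  sum-agree-except : ∀ {n} {u w : Vector Carrier n} (v : Fin n) →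
    (∀ i → i ≢ v → u i ≈ w i) → sum u ∙ w v ≈ sum w ∙ u v
  sum-agree-except {suc n} {u} {w} v agree = begin
    sum u ∙ w v                        ≈⟨ ∙-congʳ (sum-remove u) ⟩
    (u v ∙ sum (removeAt u v)) ∙ w v   ≈⟨ ∙-congʳ (∙-congˡ removed) ⟩
    (u v ∙ sum (removeAt w v)) ∙ w v   ≈⟨ assoc _ _ _ ⟩
    u v ∙ (sum (removeAt w v) ∙ w v)   ≈⟨ comm _ _ ⟩
    (sum (removeAt w v) ∙ w v) ∙ u v   ≈⟨ ∙-congʳ (comm _ _) ⟩
    (w v ∙ sum (removeAt w v)) ∙ u v   ≈⟨ ∙-congʳ (sum-remove w) ⟨
    sum w ∙ u v                        ∎
    where
    removed : sum (removeAt u v) ≈ sum (removeAt w v)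
    removed = sum-cong-≋ (λ j → agree (punchIn v j) (FP.punchInᵢ≢i v j))

open import Algebra.Properties.AbelianGroup ℤP.+-0-abelianGroup using () renaming (∙-cancelˡ to +-cancelˡ)
open import Algebra.Properties.Semiring.Sum ℤP.+-*-semiring
  using (sum; sum-cong-≗; ∑-distrib-+; ∑-comm; *-distribʳ-sum; *-distribˡ-sum; sum-replicate-zero)

sumℤ≡sum : ∀ {n} (f : Fin n → ℤ) → sumℤ f ≡ sum f
sumℤ≡sum {zero}  f = refl
sumℤ≡sum {suc n} f = cong (_+_ (f zero)) (sumℤ≡sum (f ∘ suc))

+-sumℕ : ∀ {n} (f : Fin n → ℕ) → + sumℕ f ≡ sum (λ i → + f i)
+-sumℕ {zero}  f = refl
+-sumℕ {suc n} f = trans (ℤP.pos-+ (f zero) _) (cong (_+_ (+ f zero)) (+-sumℕ (f ∘ suc)))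

sum-neg : ∀ {n} (f : Fin n → ℤ) → sum (λ i → - f i) ≡ - sum f
sum-neg {zero}  f = refl
sum-neg {suc n} f = trans (cong (_+_ (- f zero)) (sum-neg (f ∘ suc))) (sym (ℤP.neg-distrib-+ (f zero) _))

sum-- : ∀ {n} (f g : Fin n → ℤ) → sum (λ i → f i - g i) ≡ sum f - sum g
sum-- f g = trans (∑-distrib-+ f (λ i → - g i)) (cong (_+_ (sum f)) (sum-neg g))

agree-at-by-sum : ∀ {n} {u w : Fin n → ℤ} (v : Fin n) →
  sum u ≡ sum w → (∀ i → i ≢ v → u i ≡ w i) → u v ≡ w v
agree-at-by-sum {u = u} {w} v Σu≡Σw agree = +-cancelˡ (sum w) _ _ (begin
  sum w + u v  ≡⟨ sum-agree-except ℤP.+-0-commutativeMonoid v agree ⟨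
  sum u + w v  ≡⟨ cong (λ s → s + w v) Σu≡Σw ⟩
  sum w + w v  ∎)
  where open ≡-Reasoning

δ : ∀ {n} → Fin n → Fin n → ℤ
δ v i = + (if does (i F.≟ v) then 1 else 0)

δ-diag : ∀ {n} (v : Fin n) → δ v v ≡ 1ℤ
δ-diag v with v F.≟ v
... | yes _   = refl
... | no v≢v = contradiction refl v≢v

δ-≢ : ∀ {n} {v i : Fin n} → i ≢ v → δ v i ≡ 0ℤ
δ-≢ {v = v} {i} i≢v with i F.≟ v
... | yes i≡v = contradiction i≡v i≢v
... | no _    = refl

sum-δ : ∀ {n} (v : Fin n) (g : Fin n → ℤ) → sum (λ i → δ v i * g i) ≡ g v
sum-δ {n} v g = begin
  sum (λ i → δ v i * g i)           ≡⟨ ℤP.+-identityʳ _ ⟨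
  sum (λ i → δ v i * g i) + 0ℤ       ≡⟨ sum-agree-except ℤP.+-0-commutativeMonoid v vanish ⟩
  sum {n} (λ _ → 0ℤ) + δ v v * g v   ≡⟨ cong₂ (λ s d → s + d * g v) (sum-replicate-zero n) (δ-diag v) ⟩
  0ℤ + 1ℤ * g v                      ≡⟨ trans (ℤP.+-identityˡ _) (ℤP.*-identityˡ (g v)) ⟩
  g v                                ∎
  where
  open ≡-Reasoning
  vanish : ∀ i → i ≢ v → δ v i * g i ≡ 0ℤ
  vanish i i≢v = trans (cong (_* g i) (δ-≢ i≢v)) (ℤP.*-zeroˡ (g i))

open import Algebra.Properties.CommutativeMonoid.Sum ℕP.*-1-commutativeMonoid
  using () renaming (sum to ∏)

decode : ∀ {n} (B : Fin n → ℕ) → Fin (∏ B) → (i : Fin n) → Fin (B i)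
decode {suc n} B k zero    = proj₁ (F.remQuot {B zero} (∏ {n} (B ∘ suc)) k)
decode {suc n} B k (suc i) = decode (B ∘ suc) (proj₂ (F.remQuot {B zero} (∏ {n} (B ∘ suc)) k)) i

encode : ∀ {n} (B : Fin n → ℕ) → ((i : Fin n) → Fin (B i)) → Fin (∏ B)
encode {zero}  B d = zero
encode {suc n} B d = F.combine (d zero) (encode (B ∘ suc) (λ i → d (suc i)))

decode-encode : ∀ {n} (B : Fin n → ℕ) d i → decode B (encode B d) i ≡ d i
decode-encode {suc n} B d zero    = cong proj₁ (FP.remQuot-combine {B zero} (d zero) _)
decode-encode {suc n} B d (suc i) = trans
  (cong (λ qr → decode (B ∘ suc) (proj₂ qr) i) (FP.remQuot-combine {B zero} (d zero) _))
  (decode-encode (B ∘ suc) (λ i → d (suc i)) i)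

decode-injective : ∀ {n} (B : Fin n → ℕ) {k l} → (∀ i → decode B k i ≡ decode B l i) → k ≡ l
decode-injective {zero}  B {zero} {zero} _ = refl
decode-injective {suc n} B {k} {l} same = begin
  k                                ≡⟨ FP.combine-remQuot {B zero} P k ⟨
  F.combine (decode B k zero) k′   ≡⟨ cong₂ F.combine (same zero) k′≡l′ ⟩
  F.combine (decode B l zero) l′   ≡⟨ FP.combine-remQuot {B zero} P l ⟩
  l                                ∎
  where
  open ≡-Reasoning
  P : ℕ
  P = ∏ {n} (B ∘ suc)
  k′ l′ : Fin P
  k′ = proj₂ (F.remQuot {B zero} P k)
  l′ = proj₂ (F.remQuot {B zero} P l)
  k′≡l′ : k′ ≡ l′
  k′≡l′ = decode-injective (B ∘ suc) (λ i → same (suc i))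

p-q≡m*t⇒p≡q : ∀ {m p q} t → p ℕ.< m → q ℕ.< m → + p - + q ≡ + m * t → p ≡ q
p-q≡m*t⇒p≡q {m} {p} {q} t p<m q<m p-q≡mt = byQuotient t (begin
  + p                ≡⟨ shift (+ p) (+ q) ⟩
  + q + (+ p - + q)  ≡⟨ cong (_+_ (+ q)) p-q≡mt ⟩
  + q + + m * t      ∎)
  where
  open ≡-Reasoning
  shift : ∀ x y → x ≡ y + (x - y)
  shift = solve-∀
  unshift : ∀ x y s → x ≡ y + - s → y ≡ x + s
  unshift x y s refl = undo y s
    where undo : ∀ y s → y ≡ y + - s + s
          undo = solve-∀
  +-multiple : ∀ s k → + (s ℕ.+ m ℕ.* suc k) ≡ + s + + m * + suc k
  +-multiple s k = trans (ℤP.pos-+ s _) (cong (_+_ (+ s)) (ℤP.pos-* m (suc k)))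
  below-multiple : ∀ {r} s k → r ℕ.< m → r ≢ s ℕ.+ m ℕ.* suc k
  below-multiple {r} s k r<m refl = ℕP.<⇒≱ r<m (ℕP.≤-trans (ℕP.m≤m*n m (suc k)) (ℕP.m≤n+m (m ℕ.* suc k) s))
  byQuotient : ∀ t → + p ≡ + q + + m * t → p ≡ q
  byQuotient (+ zero) p≡q = ℤP.+-injective (trans p≡q (trans (cong (_+_ (+ q)) (ℤP.*-zeroʳ (+ m))) (ℤP.+-identityʳ (+ q))))
  byQuotient (+ suc k) p≡q+mk = contradiction (ℤP.+-injective (trans p≡q+mk (sym (+-multiple q k)))) (below-multiple q k p<m)
  byQuotient -[1+ k ] p≡q-mk = contradiction (ℤP.+-injective (trans q≡p+mk (sym (+-multiple p k)))) (below-multiple p k q<m)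
    where
    q≡p+mk : + q ≡ + p + + m * + suc k
    q≡p+mk = unshift (+ p) (+ q) (+ m * + suc k) (trans p≡q-mk (cong (_+_ (+ q)) (sym (ℤP.neg-distribʳ-* (+ m) (+ suc k)))))

toℕ-Fin1 : ∀ {m} → m ≡ 1 → (d : Fin m) → toℕ d ≡ 0
toℕ-Fin1 refl zero = refl

Fin1-unique : ∀ {m} → m ≡ 1 → (d d′ : Fin m) → d ≡ d′
Fin1-unique refl zero zero = refl

m^[n∸1]*m≡m^n : ∀ c e → .⦃ _ : ℕ.NonZero e ⦄ → c ℕ.^ (e ℕ.∸ 1) ℕ.* c ≡ c ℕ.^ e
m^[n∸1]*m≡m^n c (suc e) = ℕP.*-comm (c ℕ.^ e) c

∏-by-layers : ∀ {n} (w : Fin 3 → ℕ) (layer : Fin n → Fin 3) → ∏ (w ∘ layer) ≡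
  w 0F ℕ.^ layerSize layer 0F ℕ.* w 1F ℕ.^ layerSize layer 1F ℕ.* w 2F ℕ.^ layerSize layer 2F
∏-by-layers {zero}  w layer = refl
∏-by-layers {suc n} w layer with layer zero | ∏-by-layers w (layer ∘ suc)
... | 0F | ih = trans (cong (w 0F ℕ.*_) ih) (first (w 0F) (rest 0F) (rest 1F) (rest 2F))
  where rest : Fin 3 → ℕ
        rest ℓ = w ℓ ℕ.^ layerSize (layer ∘ suc) ℓ
        first : ∀ a x y z → a ℕ.* (x ℕ.* y ℕ.* z) ≡ a ℕ.* x ℕ.* y ℕ.* z
        first = ℕ-solve-∀
... | 1F | ih = trans (cong (w 1F ℕ.*_) ih) (second (w 1F) (rest 0F) (rest 1F) (rest 2F))
  where rest : Fin 3 → ℕ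
        rest ℓ = w ℓ ℕ.^ layerSize (layer ∘ suc) ℓ
        second : ∀ a x y z → a ℕ.* (x ℕ.* y ℕ.* z) ≡ x ℕ.* (a ℕ.* y) ℕ.* z
        second = ℕ-solve-∀
... | 2F | ih = trans (cong (w 2F ℕ.*_) ih) (third (w 2F) (rest 0F) (rest 1F) (rest 2F))
  where rest : Fin 3 → ℕ
        rest ℓ = w ℓ ℕ.^ layerSize (layer ∘ suc) ℓ
        third : ∀ a x y z → a ℕ.* (x ℕ.* y ℕ.* z) ≡ x ℕ.* y ℕ.* (a ℕ.* z)
        third = ℕ-solve-∀

member-of-layer : ∀ {n} (layer : Fin n → Fin 3) ℓ → 1 ℕ.≤ layerSize layer ℓ → Σ (Fin n) (λ v → layer v ≡ ℓ)
member-of-layer {suc n} layer ℓ nonempty with layer zero F.≟ ℓ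
... | yes first∈ℓ = zero , first∈ℓ
... | no _ with member-of-layer (layer ∘ suc) ℓ nonempty
...   | v , v∈ℓ = suc v , v∈ℓ

Loopless : ∀ {n} → Digraph n → Set
Loopless A = ∀ i → A i i ≡ 0

Lᵀ : ∀ {n} → Digraph n → Vecℤ n → Vecℤ n
Lᵀ A z i = sumℤ (λ j → Laplacian A j i * z j)

module _ {n} {A : Digraph n} (loopless : Loopless A) where

  Lᵀ-apply : ∀ z i → Lᵀ A z i ≡ + outdeg A i * z i - sum (λ j → + A j i * z j)
  Lᵀ-apply z i = begin
    Lᵀ A z i                                                          ≡⟨ sumℤ≡sum (λ j → Laplacian A j i * z j) ⟩
    sum (λ j → Laplacian A j i * z j)                                 ≡⟨ sum-cong-≗ entry ⟩
    sum (λ j → δ i j * (+ outdeg A j * z j) - + A j i * z j)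
      ≡⟨ sum-- (λ j → δ i j * (+ outdeg A j * z j)) (λ j → + A j i * z j) ⟩
    sum (λ j → δ i j * (+ outdeg A j * z j)) - sum (λ j → + A j i * z j)
      ≡⟨ cong (_- sum (λ j → + A j i * z j)) (sum-δ i (λ j → + outdeg A j * z j)) ⟩
    + outdeg A i * z i - sum (λ j → + A j i * z j)                   ∎
    where
    open ≡-Reasoning
    entry : ∀ j → Laplacian A j i * z j ≡ δ i j * (+ outdeg A j * z j) - + A j i * z j
    entry j with j F.≟ i
    ... | yes refl rewrite loopless j = diagonal (+ outdeg A j) (z j)
      where diagonal : ∀ d y → d * y ≡ 1ℤ * (d * y) - 0ℤ * y
            diagonal = solve-∀
    ... | no _ = offDiagonal (+ A j i) (+ outdeg A j) (z j)
      where offDiagonal : ∀ a d y → - a * y ≡ 0ℤ * (d * y) - a * y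
            offDiagonal = solve-∀

  sum-Lᵀ : ∀ z → sum (Lᵀ A z) ≡ 0ℤ
  sum-Lᵀ z = begin
    sum (Lᵀ A z)                                                         ≡⟨ sum-cong-≗ (Lᵀ-apply z) ⟩
    sum (λ i → + outdeg A i * z i - sum (λ j → + A j i * z j))
      ≡⟨ sum-- (λ i → + outdeg A i * z i) (λ i → sum (λ j → + A j i * z j)) ⟩
    sum (λ i → + outdeg A i * z i) - sum (λ i → sum (λ j → + A j i * z j)) ≡⟨ cong (_-_ out) inflow ⟩
    out - out                                                            ≡⟨ ℤP.+-inverseʳ out ⟩
    0ℤ                                                                   ∎
    where
    open ≡-Reasoning
    out : ℤ
    out = sum (λ i → + outdeg A i * z i)
    inflow : sum (λ i → sum (λ j → + A j i * z j)) ≡ out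
    inflow = begin
      sum (λ i → sum (λ j → + A j i * z j))  ≡⟨ ∑-comm (λ i j → + A j i * z j) ⟩
      sum (λ j → sum (λ i → + A j i * z j))  ≡⟨ sum-cong-≗ (λ j → *-distribʳ-sum (z j) (λ i → + A j i)) ⟨
      sum (λ j → sum (λ i → + A j i) * z j)  ≡⟨ sum-cong-≗ (λ j → cong (_* z j) (+-sumℕ (A j))) ⟨
      out                                    ∎

module LayerSums {n} (layer : Fin n → Fin 3) where

  b c : ℕ
  b = layerSize layer 1F
  c = layerSize layer 2F

  indicator : Fin 3 → Fin 3 → ℕ
  indicator ℓ ℓ′ = if does (ℓ′ F.≟ ℓ) then 1 else 0

  χ : Fin 3 → Fin n → ℤ
  χ ℓ j = + indicator ℓ (layer j)

  sum-χ : ∀ ℓ → sum (χ ℓ) ≡ + layerSize layer ℓ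
  sum-χ ℓ = sym (+-sumℕ (λ j → indicator ℓ (layer j)))

  layerSum : Fin 3 → Vecℤ n → ℤ
  layerSum ℓ g = sum (λ j → χ ℓ j * g j)

  layerSum-cong : ∀ ℓ {g h : Vecℤ n} → (∀ j → layer j ≡ ℓ → g j ≡ h j) → layerSum ℓ g ≡ layerSum ℓ h
  layerSum-cong ℓ {g} {h} agree = sum-cong-≗ entry
    where
    entry : ∀ j → χ ℓ j * g j ≡ χ ℓ j * h j
    entry j with layer j F.≟ ℓ
    ... | yes inℓ = cong (1ℤ *_) (agree j inℓ)
    ... | no _    = trans (ℤP.*-zeroˡ (g j)) (sym (ℤP.*-zeroˡ (h j)))

  layerSum-+ : ∀ ℓ (g h : Vecℤ n) → layerSum ℓ (λ j → g j + h j) ≡ layerSum ℓ g + layerSum ℓ h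
  layerSum-+ ℓ g h = trans (sum-cong-≗ (λ j → ℤP.*-distribˡ-+ (χ ℓ j) (g j) (h j)))
                           (∑-distrib-+ (λ j → χ ℓ j * g j) (λ j → χ ℓ j * h j))

  layerSum-* : ∀ ℓ k (g : Vecℤ n) → layerSum ℓ (λ j → k * g j) ≡ k * layerSum ℓ g
  layerSum-* ℓ k g = trans (sum-cong-≗ (λ j → swap (χ ℓ j) k (g j)))
                           (sym (*-distribˡ-sum k (λ j → χ ℓ j * g j)))
    where swap : ∀ x k y → x * (k * y) ≡ k * (x * y)
          swap = solve-∀

  layerSum-neg : ∀ ℓ (g : Vecℤ n) → layerSum ℓ (λ j → - g j) ≡ - layerSum ℓ g
  layerSum-neg ℓ g = trans (sum-cong-≗ (λ j → sym (ℤP.neg-distribʳ-* (χ ℓ j) (g j))))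
                           (sum-neg (λ j → χ ℓ j * g j))

  layerSum-const : ∀ ℓ k → layerSum ℓ (λ _ → k) ≡ + layerSize layer ℓ * k
  layerSum-const ℓ k = trans (sym (*-distribʳ-sum k (χ ℓ))) (cong (_* k) (sum-χ ℓ))

  layerSum-constant-on : ∀ ℓ {x κ} → (∀ w → layer w ≡ ℓ → x w ≡ κ) → layerSum ℓ x ≡ + layerSize layer ℓ * κ
  layerSum-constant-on ℓ {x} {κ} x≡κ = trans (layerSum-cong ℓ x≡κ) (layerSum-const ℓ κ)

  layerSum-δ : ∀ {ℓ v} → layer v ≡ ℓ → ∀ k → layerSum ℓ (λ j → δ v j * k) ≡ k
  layerSum-δ {ℓ} {v} v∈ℓ k = begin
    sum (λ j → χ ℓ j * (δ v j * k))   ≡⟨ sum-cong-≗ (λ j → swap (χ ℓ j) (δ v j) k) ⟩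
    sum (λ j → δ v j * (χ ℓ j * k))   ≡⟨ sum-δ v (λ j → χ ℓ j * k) ⟩
    χ ℓ v * k                          ≡⟨ cong (_* k) χℓv≡1 ⟩
    1ℤ * k                             ≡⟨ ℤP.*-identityˡ k ⟩
    k                                  ∎
    where
    open ≡-Reasoning
    swap : ∀ x d k → x * (d * k) ≡ d * (x * k)
    swap = solve-∀
    χℓv≡1 : χ ℓ v ≡ 1ℤ
    χℓv≡1 with layer v F.≟ ℓ
    ... | yes _ = refl
    ... | no v∉ℓ = contradiction v∈ℓ v∉ℓ

  sum-by-layers : ∀ (g : Vecℤ n) → sum g ≡ layerSum 0F g + layerSum 1F g + layerSum 2F g
  sum-by-layers g = begin
    sum g                                                         ≡⟨ sum-cong-≗ entry ⟩
    sum (λ j → χ 0F j * g j + χ 1F j * g j + χ 2F j * g j)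
      ≡⟨ ∑-distrib-+ (λ j → χ 0F j * g j + χ 1F j * g j) (λ j → χ 2F j * g j) ⟩
    sum (λ j → χ 0F j * g j + χ 1F j * g j) + layerSum 2F g
      ≡⟨ cong (_+ layerSum 2F g) (∑-distrib-+ (λ j → χ 0F j * g j) (λ j → χ 1F j * g j)) ⟩
    layerSum 0F g + layerSum 1F g + layerSum 2F g                 ∎
    where
    open ≡-Reasoning
    entry : ∀ j → g j ≡ χ 0F j * g j + χ 1F j * g j + χ 2F j * g j
    entry j with layer j
    ... | 0F = in0 (g j)
      where in0 : ∀ y → y ≡ 1ℤ * y + 0ℤ * y + 0ℤ * y
            in0 = solve-∀
    ... | 1F = in1 (g j)
      where in1 : ∀ y → y ≡ 0ℤ * y + 1ℤ * y + 0ℤ * y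
            in1 = solve-∀
    ... | 2F = in2 (g j)
      where in2 : ∀ y → y ≡ 0ℤ * y + 0ℤ * y + 1ℤ * y
            in2 = solve-∀

  Balanced : Vecℤ n → Set
  Balanced x = Σ ℤ (λ κ → ∀ w → layer w ≡ 2F → x w ≡ κ) × sum x ≡ 0ℤ

  layerSum₀₁-balanced : ∀ {x κ} → (∀ w → layer w ≡ 2F → x w ≡ κ) → sum x ≡ 0ℤ →
    layerSum 0F x + layerSum 1F x ≡ - (+ c * κ)
  layerSum₀₁-balanced {x} {κ} x≡κ Σx≡0 = begin
    layerSum 0F x + layerSum 1F x                          ≡⟨ cancel (layerSum 0F x + layerSum 1F x) (+ c * κ) ⟩
    (layerSum 0F x + layerSum 1F x) + + c * κ - + c * κ    ≡⟨ cong (λ s → s - + c * κ) layers ⟩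
    0ℤ - + c * κ                                           ≡⟨ ℤP.+-identityˡ _ ⟩
    - (+ c * κ)                                            ∎
    where
    open ≡-Reasoning
    cancel : ∀ s k → s ≡ s + k - k
    cancel = solve-∀
    layers : layerSum 0F x + layerSum 1F x + + c * κ ≡ 0ℤ
    layers = trans (cong (_+_ (layerSum 0F x + layerSum 1F x)) (sym (layerSum-constant-on 2F x≡κ)))
                   (trans (sym (sum-by-layers x)) Σx≡0)

module ThreeLayers {n} {A : Digraph n} {layer : Fin n → Fin 3} (singleFlow : SingleFlow3 A layer) where

  open LayerSums layer public

  arrows : Fin 3 → Fin 3 → ℕ
  arrows ℓ ℓ′ = if does (toℕ ℓ′ ℕ.≟ suc (toℕ ℓ)) then 1 else 0

  A≡arrows : ∀ u v → A u v ≡ arrows (layer u) (layer v)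
  A≡arrows u v = byDecision (toℕ (layer v) ℕ.≟ suc (toℕ (layer u)))
    where
    byDecision : (next? : Dec (toℕ (layer v) ≡ suc (toℕ (layer u)))) → A u v ≡ (if does next? then 1 else 0)
    byDecision (yes next) = proj₁ (singleFlow u v) next
    byDecision (no ¬next) = proj₂ (singleFlow u v) ¬next

  loopless : Loopless A
  loopless i = proj₂ (singleFlow i i) (ℕP.1+n≢n ∘ sym)

  Lᵀ-in-layer : ∀ {i ℓ} → layer i ≡ ℓ → (out into : Fin 3 → ℕ) →
    (∀ ℓ′ → arrows ℓ ℓ′ ≡ out ℓ′) → (∀ ℓ′ → arrows ℓ′ ℓ ≡ into ℓ′) → (z : Vecℤ n) →
    Lᵀ A z i ≡ sum (λ j → + out (layer j)) * z i - sum (λ j → + into (layer j) * z j)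
  Lᵀ-in-layer {i} {ℓ} i∈ℓ out into outTable intoTable z =
    trans (Lᵀ-apply loopless z i) (cong₂ (λ d s → d * z i - s) outdeg≡ inflow≡)
    where
    open ≡-Reasoning
    outdeg≡ : + outdeg A i ≡ sum (λ j → + out (layer j))
    outdeg≡ = trans (+-sumℕ (A i)) (sum-cong-≗ (λ j → cong +_ (begin
      A i j                      ≡⟨ A≡arrows i j ⟩
      arrows (layer i) (layer j) ≡⟨ cong (λ ℓ → arrows ℓ (layer j)) i∈ℓ ⟩
      arrows ℓ (layer j)         ≡⟨ outTable (layer j) ⟩
      out (layer j)              ∎)))
    inflow≡ : sum (λ j → + A j i * z j) ≡ sum (λ j → + into (layer j) * z j)
    inflow≡ = sum-cong-≗ (λ j → cong (λ a → + a * z j) (begin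
      A j i                      ≡⟨ A≡arrows j i ⟩
      arrows (layer j) (layer i) ≡⟨ cong (arrows (layer j)) i∈ℓ ⟩
      arrows (layer j) ℓ         ≡⟨ intoTable (layer j) ⟩
      into (layer j)             ∎))

  Lᵀ-layer₀ : ∀ {i} → layer i ≡ 0F → (z : Vecℤ n) → Lᵀ A z i ≡ + b * z i
  Lᵀ-layer₀ {i} i∈0 z = begin
    Lᵀ A z i
      ≡⟨ Lᵀ-in-layer i∈0 (indicator 1F) (λ _ → 0) (λ { 0F → refl ; 1F → refl ; 2F → refl })
                                                  (λ { 0F → refl ; 1F → refl ; 2F → refl }) z ⟩
    sum (χ 1F) * z i - sum (λ j → 0ℤ * z j)
      ≡⟨ cong₂ (λ d s → d * z i - s) (sum-χ 1F) (trans (sum-cong-≗ (λ j → ℤP.*-zeroˡ (z j))) (sum-replicate-zero n)) ⟩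
    + b * z i - 0ℤ                                   ≡⟨ ℤP.+-identityʳ _ ⟩
    + b * z i                                        ∎
    where open ≡-Reasoning

  Lᵀ-layer₁ : ∀ {i} → layer i ≡ 1F → (z : Vecℤ n) → Lᵀ A z i ≡ + c * z i - layerSum 0F z
  Lᵀ-layer₁ {i} i∈1 z = begin
    Lᵀ A z i
      ≡⟨ Lᵀ-in-layer i∈1 (indicator 2F) (indicator 0F) (λ { 0F → refl ; 1F → refl ; 2F → refl })
                                                       (λ { 0F → refl ; 1F → refl ; 2F → refl }) z ⟩
    sum (χ 2F) * z i - layerSum 0F z                 ≡⟨ cong (λ d → d * z i - layerSum 0F z) (sum-χ 2F) ⟩
    + c * z i - layerSum 0F z                        ∎
    where open ≡-Reasoning

  Lᵀ-layer₂ : ∀ {i} → layer i ≡ 2F → (z : Vecℤ n) → Lᵀ A z i ≡ - layerSum 1F z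
  Lᵀ-layer₂ {i} i∈2 z = begin
    Lᵀ A z i
      ≡⟨ Lᵀ-in-layer i∈2 (λ _ → 0) (indicator 1F) (λ { 0F → refl ; 1F → refl ; 2F → refl })
                                                  (λ { 0F → refl ; 1F → refl ; 2F → refl }) z ⟩
    sum {n} (λ _ → 0ℤ) * z i - layerSum 1F z        ≡⟨ cong (λ d → d * z i - layerSum 1F z) (sum-replicate-zero n) ⟩
    0ℤ * z i - layerSum 1F z                         ≡⟨ cong (_- layerSum 1F z) (ℤP.*-zeroˡ (z i)) ⟩
    0ℤ - layerSum 1F z                               ≡⟨ ℤP.+-identityˡ _ ⟩
    - layerSum 1F z                                  ∎
    where open ≡-Reasoning

  torsion⇒balanced : ∀ {w₀} → layer w₀ ≡ 2F → ∀ x → IsTorsion A x → Balanced x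
  torsion⇒balanced {w₀} w₀∈2 x (suc m , _ , z , mx≡Lᵀz) = (x w₀ , constant) , sum≡0
    where
    constant : ∀ w → layer w ≡ 2F → x w ≡ x w₀
    constant w w∈2 = ℤP.*-cancelˡ-≡ (+ suc m) (x w) (x w₀) (begin
      + suc m * x w    ≡⟨ mx≡Lᵀz w ⟩
      Lᵀ A z w         ≡⟨ Lᵀ-layer₂ w∈2 z ⟩
      - layerSum 1F z  ≡⟨ Lᵀ-layer₂ w₀∈2 z ⟨
      Lᵀ A z w₀        ≡⟨ mx≡Lᵀz w₀ ⟨
      + suc m * x w₀   ∎)
      where open ≡-Reasoning
    sum≡0 : sum x ≡ 0ℤ
    sum≡0 = ℤP.*-cancelˡ-≡ (+ suc m) (sum x) 0ℤ (begin
      + suc m * sum x                ≡⟨ *-distribˡ-sum (+ suc m) x ⟩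
      sum (λ i → + suc m * x i)      ≡⟨ sum-cong-≗ mx≡Lᵀz ⟩
      sum (Lᵀ A z)                   ≡⟨ sum-Lᵀ loopless z ⟩
      0ℤ                             ≡⟨ ℤP.*-zeroʳ (+ suc m) ⟨
      + suc m * 0ℤ                   ∎)
      where open ≡-Reasoning

  balanced⇒torsion : 1 ℕ.≤ b → 1 ℕ.≤ c → ∀ x → Balanced x → IsTorsion A x
  balanced⇒torsion 1≤b 1≤c x ((κ , x≡κ) , Σx≡0) = b ℕ.* c , ℕP.*-mono-≤ 1≤b 1≤c , z , fires
    where
    open ≡-Reasoning
    -- Solves Lᵀ z = b c x one layer at a time, starting from the first.
    potential : Fin 3 → Fin n → ℤ
    potential 0F j = + c * x j
    potential 1F j = + b * x j + layerSum 0F x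
    potential 2F j = 0ℤ

    z : Vecℤ n
    z j = potential (layer j) j

    z-on : ∀ {j ℓ} → layer j ≡ ℓ → z j ≡ potential ℓ j
    z-on {j} j∈ℓ = cong (λ ℓ → potential ℓ j) j∈ℓ

    layerSum₀-z : layerSum 0F z ≡ + c * layerSum 0F x
    layerSum₀-z = trans (layerSum-cong 0F (λ j → z-on)) (layerSum-* 0F (+ c) x)

    layerSum₁-z : layerSum 1F z ≡ + b * layerSum 1F x + + b * layerSum 0F x
    layerSum₁-z = begin
      layerSum 1F z                                              ≡⟨ layerSum-cong 1F (λ j → z-on) ⟩
      layerSum 1F (λ j → + b * x j + layerSum 0F x)
        ≡⟨ layerSum-+ 1F (λ j → + b * x j) (λ _ → layerSum 0F x) ⟩
      layerSum 1F (λ j → + b * x j) + layerSum 1F (λ _ → layerSum 0F x)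
        ≡⟨ cong₂ _+_ (layerSum-* 1F (+ b) x) (layerSum-const 1F (layerSum 0F x)) ⟩
      + b * layerSum 1F x + + b * layerSum 0F x                  ∎

    bc≡ : + (b ℕ.* c) ≡ + b * + c
    bc≡ = ℤP.pos-* b c

    fires : ∀ i → + (b ℕ.* c) * x i ≡ Lᵀ A z i
    fires i with layer i in i∈ℓ
    ... | 0F = begin
      + (b ℕ.* c) * x i          ≡⟨ cong (_* x i) bc≡ ⟩
      + b * + c * x i            ≡⟨ ℤP.*-assoc (+ b) (+ c) (x i) ⟩
      + b * (+ c * x i)          ≡⟨ cong (_*_ (+ b)) (z-on i∈ℓ) ⟨
      + b * z i                  ≡⟨ Lᵀ-layer₀ i∈ℓ z ⟨
      Lᵀ A z i                   ∎
    ... | 1F = begin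
      + (b ℕ.* c) * x i                                   ≡⟨ cong (_* x i) bc≡ ⟩
      + b * + c * x i                                     ≡⟨ rearrange (+ b) (+ c) (x i) (layerSum 0F x) ⟩
      + c * (+ b * x i + layerSum 0F x) - + c * layerSum 0F x
        ≡⟨ cong₂ (λ p q → + c * p - q) (z-on i∈ℓ) layerSum₀-z ⟨
      + c * z i - layerSum 0F z                           ≡⟨ Lᵀ-layer₁ i∈ℓ z ⟨
      Lᵀ A z i                                            ∎
      where rearrange : ∀ b c y s → b * c * y ≡ c * (b * y + s) - c * s
            rearrange = solve-∀
    ... | 2F = begin
      + (b ℕ.* c) * x i                                   ≡⟨ cong₂ _*_ bc≡ (x≡κ i i∈ℓ) ⟩
      + b * + c * κ                                       ≡⟨ rearrange (+ b) (+ c) κ ⟩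
      - (+ b * - (+ c * κ))
        ≡⟨ cong (λ s → - (+ b * s)) (layerSum₀₁-balanced x≡κ Σx≡0) ⟨
      - (+ b * (layerSum 0F x + layerSum 1F x))          ≡⟨ cong -_ (distrib (+ b) (layerSum 0F x) (layerSum 1F x)) ⟩
      - (+ b * layerSum 1F x + + b * layerSum 0F x)      ≡⟨ cong -_ layerSum₁-z ⟨
      - layerSum 1F z                                     ≡⟨ Lᵀ-layer₂ i∈ℓ z ⟨
      Lᵀ A z i                                            ∎
      where rearrange : ∀ b c k → b * c * k ≡ - (b * - (c * k))
            rearrange = solve-∀
            distrib : ∀ b s t → b * (s + t) ≡ b * t + b * s
            distrib = solve-∀

module Representatives {n} {A : Digraph n} {layer : Fin n → Fin 3} (singleFlow : SingleFlow3 A layer)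
  {v₀ : Fin n} (v₀∈1 : layer v₀ ≡ 1F)
  (1≤b : 1 ℕ.≤ layerSize layer 1F) (1≤c : 1 ℕ.≤ layerSize layer 2F) where

  open ThreeLayers singleFlow

  instance
    b≢0 : ℕ.NonZero b
    b≢0 = ℕ.>-nonZero 1≤b
    c≢0 : ℕ.NonZero c
    c≢0 = ℕ.>-nonZero 1≤c

  radix : Fin 3 → ℕ
  radix 0F = b
  radix 1F = c
  radix 2F = 1

  -- Positions whose entry is forced (at v₀ by the zero sum, on V₃ to be 0) get radix 1.
  base : Fin n → ℕ
  base i = if does (i F.≟ v₀) then 1 else radix (layer i)

  N : ℕ
  N = ∏ base

  digit : Fin N → (i : Fin n) → Fin (base i)
  digit = decode base

  digits : Fin N → Vecℤ n
  digits k i = + toℕ (digit k i)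

  rep : Fin N → Vecℤ n
  rep k i = digits k i - δ v₀ i * sum (digits k)

  off-layer₁ : ∀ {i ℓ} → layer i ≡ ℓ → ℓ ≢ 1F → i ≢ v₀
  off-layer₁ i∈ℓ ℓ≢1 refl = ℓ≢1 (trans (sym i∈ℓ) v₀∈1)

  base-v₀ : base v₀ ≡ 1
  base-v₀ with v₀ F.≟ v₀
  ... | yes _     = refl
  ... | no v₀≢v₀ = contradiction refl v₀≢v₀

  base-≢ : ∀ {i ℓ} → i ≢ v₀ → layer i ≡ ℓ → base i ≡ radix ℓ
  base-≢ {i} i≢v₀ i∈ℓ with i F.≟ v₀
  ... | yes i≡v₀ = contradiction i≡v₀ i≢v₀
  ... | no _     = cong radix i∈ℓ

  base-layer₂ : ∀ {i} → layer i ≡ 2F → base i ≡ 1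
  base-layer₂ i∈2 = base-≢ (off-layer₁ i∈2 λ ()) i∈2

  N≡ : N ≡ b ℕ.^ layerSize layer 0F ℕ.* c ℕ.^ (b ℕ.∸ 1)
  N≡ = ℕP.*-cancelʳ-≡ N _ c (begin
    N ℕ.* c                                 ≡⟨ cong (λ ℓ → N ℕ.* radix ℓ) v₀∈1 ⟨
    N ℕ.* radix (layer v₀)                  ≡⟨ sum-agree-except ℕP.*-1-commutativeMonoid v₀ (λ i i≢v₀ → base-≢ i≢v₀ refl) ⟩
    ∏ (radix ∘ layer) ℕ.* base v₀           ≡⟨ cong (∏ (radix ∘ layer) ℕ.*_) base-v₀ ⟩
    ∏ (radix ∘ layer) ℕ.* 1                 ≡⟨ ℕP.*-identityʳ _ ⟩
    ∏ (radix ∘ layer)                       ≡⟨ ∏-by-layers radix layer ⟩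
    bᵃ ℕ.* c ℕ.^ b ℕ.* 1 ℕ.^ layerSize layer 2F
      ≡⟨ trans (cong (bᵃ ℕ.* c ℕ.^ b ℕ.*_) (ℕP.^-zeroˡ (layerSize layer 2F))) (ℕP.*-identityʳ _) ⟩
    bᵃ ℕ.* c ℕ.^ b                          ≡⟨ cong (bᵃ ℕ.*_) (m^[n∸1]*m≡m^n c b) ⟨
    bᵃ ℕ.* (c ℕ.^ (b ℕ.∸ 1) ℕ.* c)          ≡⟨ ℕP.*-assoc bᵃ _ c ⟨
    bᵃ ℕ.* c ℕ.^ (b ℕ.∸ 1) ℕ.* c            ∎)
    where
    open ≡-Reasoning
    bᵃ : ℕ
    bᵃ = b ℕ.^ layerSize layer 0F

  rep-≢ : ∀ k {i} → i ≢ v₀ → rep k i ≡ digits k i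
  rep-≢ k {i} i≢v₀ = begin
    digits k i - δ v₀ i * sum (digits k)   ≡⟨ cong (λ d → digits k i - d * sum (digits k)) (δ-≢ i≢v₀) ⟩
    digits k i - 0ℤ * sum (digits k)       ≡⟨ cong (λ p → digits k i - p) (ℤP.*-zeroˡ (sum (digits k))) ⟩
    digits k i - 0ℤ                         ≡⟨ ℤP.+-identityʳ (digits k i) ⟩
    digits k i                              ∎
    where open ≡-Reasoning

  sum-rep : ∀ k → sum (rep k) ≡ 0ℤ
  sum-rep k = begin
    sum (λ i → digits k i - δ v₀ i * sum (digits k))   ≡⟨ sum-- (digits k) (λ i → δ v₀ i * sum (digits k)) ⟩
    sum (digits k) - sum (λ i → δ v₀ i * sum (digits k)) ≡⟨ cong (_-_ (sum (digits k))) (sum-δ v₀ (λ _ → sum (digits k))) ⟩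
    sum (digits k) - sum (digits k)                      ≡⟨ ℤP.+-inverseʳ (sum (digits k)) ⟩
    0ℤ                                                   ∎
    where open ≡-Reasoning

  rep-balanced : ∀ k → Balanced (rep k)
  rep-balanced k = (0ℤ , vanishes) , sum-rep k
    where
    vanishes : ∀ w → layer w ≡ 2F → rep k w ≡ 0ℤ
    vanishes w w∈2 = trans (rep-≢ k (off-layer₁ w∈2 λ ())) (cong +_ (toℕ-Fin1 (base-layer₂ w∈2) (digit k w)))

  digit-< : ∀ k {i ℓ} → i ≢ v₀ → layer i ≡ ℓ → toℕ (digit k i) ℕ.< radix ℓ
  digit-< k {i} i≢v₀ i∈ℓ = subst (toℕ (digit k i) ℕ.<_) (base-≢ i≢v₀ i∈ℓ) (FP.toℕ<n (digit k i))

  module SameClass (k l : Fin N) (z : Vecℤ n) (Δ≡Lᵀz : ∀ i → rep k i - rep l i ≡ Lᵀ A z i) where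

    open ≡-Reasoning

    Δ≡ : ∀ {i} → i ≢ v₀ → digits k i - digits l i ≡ Lᵀ A z i
    Δ≡ {i} i≢v₀ = trans (cong₂ _-_ (sym (rep-≢ k i≢v₀)) (sym (rep-≢ l i≢v₀))) (Δ≡Lᵀz i)

    same-on-layer₀ : ∀ {i} → layer i ≡ 0F → digit k i ≡ digit l i
    same-on-layer₀ {i} i∈0 = FP.toℕ-injective (p-q≡m*t⇒p≡q (z i)
      (digit-< k i≢v₀ i∈0) (digit-< l i≢v₀ i∈0) (trans (Δ≡ i≢v₀) (Lᵀ-layer₀ i∈0 z)))
      where
      i≢v₀ : i ≢ v₀
      i≢v₀ = off-layer₁ i∈0 λ ()

    z-on-layer₀ : ∀ j → layer j ≡ 0F → z j ≡ 0ℤ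
    z-on-layer₀ j j∈0 = ℤP.*-cancelˡ-≡ (+ b) (z j) 0ℤ (begin
      + b * z j                  ≡⟨ Lᵀ-layer₀ j∈0 z ⟨
      Lᵀ A z j                   ≡⟨ Δ≡ (off-layer₁ j∈0 λ ()) ⟨
      digits k j - digits l j    ≡⟨ cong (λ d → + toℕ d - digits l j) (same-on-layer₀ j∈0) ⟩
      digits l j - digits l j    ≡⟨ ℤP.+-inverseʳ (digits l j) ⟩
      0ℤ                         ≡⟨ ℤP.*-zeroʳ (+ b) ⟨
      + b * 0ℤ                   ∎)

    layerSum₀-z : layerSum 0F z ≡ 0ℤ
    layerSum₀-z = trans (layerSum-cong 0F z-on-layer₀) (trans (layerSum-const 0F 0ℤ) (ℤP.*-zeroʳ (+ layerSize layer 0F)))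

    same-on-layer₁ : ∀ {i} → i ≢ v₀ → layer i ≡ 1F → digit k i ≡ digit l i
    same-on-layer₁ {i} i≢v₀ i∈1 = FP.toℕ-injective (p-q≡m*t⇒p≡q (z i)
      (digit-< k i≢v₀ i∈1) (digit-< l i≢v₀ i∈1) (begin
        digits k i - digits l i    ≡⟨ Δ≡ i≢v₀ ⟩
        Lᵀ A z i                   ≡⟨ Lᵀ-layer₁ i∈1 z ⟩
        + c * z i - layerSum 0F z  ≡⟨ cong (_-_ (+ c * z i)) layerSum₀-z ⟩
        + c * z i - 0ℤ             ≡⟨ ℤP.+-identityʳ _ ⟩
        + c * z i                  ∎))

    same-digit-off-v₀ : ∀ {i} ℓ → layer i ≡ ℓ → i ≢ v₀ → digit k i ≡ digit l i
    same-digit-off-v₀ 0F i∈0 _     = same-on-layer₀ i∈0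
    same-digit-off-v₀ 1F i∈1 i≢v₀ = same-on-layer₁ i≢v₀ i∈1
    same-digit-off-v₀ 2F i∈2 _     = Fin1-unique (base-layer₂ i∈2) _ _

    same-digit : ∀ {i} ℓ → layer i ≡ ℓ → digit k i ≡ digit l i
    same-digit {i} ℓ i∈ℓ = byDecision (i F.≟ v₀)
      where
      byDecision : Dec (i ≡ v₀) → digit k i ≡ digit l i
      byDecision (yes i≡v₀) = Fin1-unique (trans (cong base i≡v₀) base-v₀) _ _
      byDecision (no i≢v₀)  = same-digit-off-v₀ ℓ i∈ℓ i≢v₀

  rep-injective : ∀ k l → PicEq A (rep k) (rep l) → k ≡ l
  rep-injective k l (z , Δ≡Lᵀz) = decode-injective base (λ i → same-digit (layer i) refl)
    where open SameClass k l z Δ≡Lᵀz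

  module Reduction (x : Vecℤ n) (κ : ℤ) (x≡κ : ∀ w → layer w ≡ 2F → x w ≡ κ) (Σx≡0 : sum x ≡ 0ℤ) where

    q₀ : Vecℤ n
    q₀ j = x j /ℕ b

    carry : ℤ
    carry = layerSum 0F q₀

    y : Vecℤ n
    y j = x j + carry

    q₁ : Vecℤ n
    q₁ j = y j /ℕ c

    residue : Fin 3 → Fin n → ℕ
    residue 0F j = x j %ℕ b
    residue 1F j = y j %ℕ c
    residue 2F j = 0

    residue-< : ∀ ℓ j → residue ℓ j ℕ.< radix ℓ
    residue-< 0F j = n%ℕd<d (x j) b
    residue-< 1F j = n%ℕd<d (y j) c
    residue-< 2F j = ℕ.z<s

    choose : ∀ i (d : Dec (i ≡ v₀)) → Fin (if does d then 1 else radix (layer i))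
    choose i (yes _) = zero
    choose i (no _)  = F.fromℕ< (residue-< (layer i) i)

    toℕ-choose : ∀ {i} → i ≢ v₀ → (d : Dec (i ≡ v₀)) → toℕ (choose i d) ≡ residue (layer i) i
    toℕ-choose i≢v₀ (yes i≡v₀) = contradiction i≡v₀ i≢v₀
    toℕ-choose i≢v₀ (no _)     = FP.toℕ-fromℕ< _

    k : Fin N
    k = encode base (λ i → choose i (i F.≟ v₀))

    rep-k : ∀ {i ℓ} → i ≢ v₀ → layer i ≡ ℓ → rep k i ≡ + residue ℓ i
    rep-k {i} {ℓ} i≢v₀ i∈ℓ = begin
      rep k i                          ≡⟨ rep-≢ k i≢v₀ ⟩
      + toℕ (digit k i)                ≡⟨ cong (λ d → + toℕ d) (decode-encode base (λ i → choose i (i F.≟ v₀)) i) ⟩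
      + toℕ (choose i (i F.≟ v₀))      ≡⟨ cong +_ (toℕ-choose i≢v₀ (i F.≟ v₀)) ⟩
      + residue (layer i) i            ≡⟨ cong (λ ℓ → + residue ℓ i) i∈ℓ ⟩
      + residue ℓ i                    ∎
      where open ≡-Reasoning

    -- The extra firings of v₀ that clear the constant κ from the last layer.
    surplus : ℤ
    surplus = κ + layerSum 1F q₁

    firing : Fin 3 → Fin n → ℤ
    firing 0F j = - q₀ j
    firing 1F j = - q₁ j + δ v₀ j * surplus
    firing 2F j = 0ℤ

    z : Vecℤ n
    z j = firing (layer j) j

    z-on : ∀ {j ℓ} → layer j ≡ ℓ → z j ≡ firing ℓ j
    z-on {j} j∈ℓ = cong (λ ℓ → firing ℓ j) j∈ℓ

    layerSum₀-z : layerSum 0F z ≡ - carry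
    layerSum₀-z = trans (layerSum-cong 0F (λ j → z-on)) (layerSum-neg 0F q₀)

    layerSum₁-z : layerSum 1F z ≡ κ
    layerSum₁-z = begin
      layerSum 1F z                                                       ≡⟨ layerSum-cong 1F (λ j → z-on) ⟩
      layerSum 1F (λ j → - q₁ j + δ v₀ j * surplus)
        ≡⟨ layerSum-+ 1F (λ j → - q₁ j) (λ j → δ v₀ j * surplus) ⟩
      layerSum 1F (λ j → - q₁ j) + layerSum 1F (λ j → δ v₀ j * surplus)
        ≡⟨ cong₂ _+_ (layerSum-neg 1F q₁) (layerSum-δ v₀∈1 surplus) ⟩
      - layerSum 1F q₁ + (κ + layerSum 1F q₁)                           ≡⟨ cancel κ (layerSum 1F q₁) ⟩
      κ                                                                   ∎
      where
      open ≡-Reasoning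
      cancel : ∀ κ s → - s + (κ + s) ≡ κ
      cancel = solve-∀

    fires-off-v₀ : ∀ {i} ℓ → layer i ≡ ℓ → i ≢ v₀ → rep k i - x i ≡ Lᵀ A z i
    fires-off-v₀ {i} 0F i∈0 i≢v₀ = begin
      rep k i - x i                            ≡⟨ cong (_- x i) (rep-k i≢v₀ i∈0) ⟩
      + (x i %ℕ b) - x i                       ≡⟨ cong (_-_ (+ (x i %ℕ b))) (a≡a%ℕn+[a/ℕn]*n (x i) b) ⟩
      + (x i %ℕ b) - (+ (x i %ℕ b) + q₀ i * + b) ≡⟨ rearrange (+ (x i %ℕ b)) (q₀ i) (+ b) ⟩
      + b * - q₀ i                             ≡⟨ cong (_*_ (+ b)) (z-on i∈0) ⟨
      + b * z i                                ≡⟨ Lᵀ-layer₀ i∈0 z ⟨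
      Lᵀ A z i                                 ∎
      where
      open ≡-Reasoning
      rearrange : ∀ r q b → r - (r + q * b) ≡ b * - q
      rearrange = solve-∀
    fires-off-v₀ {i} 1F i∈1 i≢v₀ = begin
      rep k i - x i                            ≡⟨ cong (_- x i) (rep-k i≢v₀ i∈1) ⟩
      + (y i %ℕ c) - x i                       ≡⟨ cong (_- x i) (residue₁ (+ (y i %ℕ c)) (a≡a%ℕn+[a/ℕn]*n (y i) c)) ⟩
      x i + carry - q₁ i * + c - x i           ≡⟨ rearrange (x i) carry (q₁ i) (+ c) surplus ⟩
      + c * (- q₁ i + 0ℤ * surplus) - - carry
        ≡⟨ cong₂ (λ p s → + c * (- q₁ i + p * surplus) - s) (δ-≢ i≢v₀) layerSum₀-z ⟨
      + c * (- q₁ i + δ v₀ i * surplus) - layerSum 0F z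
        ≡⟨ cong (λ p → + c * p - layerSum 0F z) (z-on i∈1) ⟨
      + c * z i - layerSum 0F z                ≡⟨ Lᵀ-layer₁ i∈1 z ⟨
      Lᵀ A z i                                 ∎
      where
      open ≡-Reasoning
      residue₁ : ∀ r → y i ≡ r + q₁ i * + c → r ≡ y i - q₁ i * + c
      residue₁ r y≡ = trans (cancel r (q₁ i * + c)) (cong (_- q₁ i * + c) (sym y≡))
        where cancel : ∀ r s → r ≡ r + s - s
              cancel = solve-∀
      rearrange : ∀ x carry q c e → x + carry - q * c - x ≡ c * (- q + 0ℤ * e) - - carry
      rearrange = solve-∀
    fires-off-v₀ {i} 2F i∈2 i≢v₀ = begin
      rep k i - x i          ≡⟨ cong₂ _-_ (rep-k i≢v₀ i∈2) (x≡κ i i∈2) ⟩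
      0ℤ - κ                 ≡⟨ ℤP.+-identityˡ (- κ) ⟩
      - κ                    ≡⟨ cong -_ layerSum₁-z ⟨
      - layerSum 1F z        ≡⟨ Lᵀ-layer₂ i∈2 z ⟨
      Lᵀ A z i               ∎
      where open ≡-Reasoning

    fires : ∀ i → rep k i - x i ≡ Lᵀ A z i
    fires i = byDecision (i F.≟ v₀)
      where
      balance : sum (λ j → rep k j - x j) ≡ sum (Lᵀ A z)
      balance = trans (sum-- (rep k) x) (trans (cong₂ _-_ (sum-rep k) Σx≡0) (sym (sum-Lᵀ loopless z)))
      byDecision : Dec (i ≡ v₀) → rep k i - x i ≡ Lᵀ A z i
      -- At v₀ nothing is computed: both sides sum to 0 and agree everywhere else.
      byDecision (yes refl) = agree-at-by-sum v₀ balance (λ j j≢v₀ → fires-off-v₀ (layer j) refl j≢v₀)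
      byDecision (no i≢v₀)  = fires-off-v₀ (layer i) refl i≢v₀

  rep-surjective : ∀ x → Balanced x → Σ (Fin N) (λ k → PicEq A (rep k) x)
  rep-surjective x ((κ , x≡κ) , Σx≡0) = k , z , fires
    where open Reduction x κ x≡κ Σx≡0

  jacobian-order : ∀ {w₀} → layer w₀ ≡ 2F → JacHasOrder A N
  jacobian-order w₀∈2 =
    rep ,
    (λ k → balanced⇒torsion 1≤b 1≤c (rep k) (rep-balanced k)) ,
    rep-injective ,
    (λ x torsion → rep-surjective x (torsion⇒balanced w₀∈2 x torsion))

lemma6p5 : (n : ℕ) (A : Digraph n) (layer : Fin n → Fin 3) (a b c : ℕ) →
    SingleFlow3 A layer →
    layerSize layer zero ≡ a → layerSize layer (suc zero) ≡ b → layerSize layer (suc (suc zero)) ≡ c →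
    1 ℕ.≤ a → 1 ℕ.≤ b → 1 ℕ.≤ c →
    JacHasOrder A (b ℕ.^ a ℕ.* c ℕ.^ (b ℕ.∸ 1))
lemma6p5 n A layer _ _ _ singleFlow refl refl refl _ 1≤b 1≤c =
  subst (JacHasOrder A) N≡ (jacobian-order (proj₂ (member-of-layer layer 2F 1≤c)))
  where open Representatives singleFlow (proj₂ (member-of-layer layer 1F 1≤b)) 1≤b 1≤c
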